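{- Let $n\ge 1$ and let $w\colon E(K_{n,n})\to\mathbb{Q}_{+}$ be an arbitrary non-negative weight function. Let $\mathcal{P}^w_{n,n}$ be the family of minimum $w$-weight perfect matchings of $K_{n,n}$, and let $G_w\subseteq K_{n,n}$ be the graph whose edge set is the union of the edge sets of all matchings in $\mathcal{P}^w_{n,n}$. Then \[ \mathcal{L}(\mathcal{P}^w_{n,n}) \subseteq \{G\in \mathcal{L}(\mathcal{P}_{n,n}) \mid G\subseteq G_w\}, \] i.e. $\mathcal{L}(\mathcal{P}^w_{n,n})$ is the closed interval $[\hat 0, G_w]=\{G\in\mathcal{L}(\mathcal{P}_{n,n}) \mid \hat 0\subseteq G\subseteq G_w\}$ of the lattice $\mathcal{L}(\mathcal{P}_{n,n})$.
   Context: $K_{n,n}$ is the complete bipartite graph with sides $A,B$, $|A|=|B|=n$. A subgraph $H\subseteq G$ of a graph $G$ means $V(H)=V(G)$ and $E(H)\subseteq E(G)$; all graphs considered are subgraphs of $K_{n,n}$ (so have vertex set $A\cup B$), and subgraphs are identified with their edge sets. For a family $\mathcal{F}$ of subgraphs of $K_{n,n}$, a subgraph $G$ is $\mathcal{F}$-covered if there is a nonempty $S\subseteq\mathcal{F}$ with $E(G)=\bigcup_{H\in S}E(H)$. Let $\mathcal{C}(\mathcal{F})$ be the set of $\mathcal{F}$-covered subgraphs and $\hat 0$ the empty subgraph (no edges); $\mathcal{L}(\mathcal{F})$ denotes the set $\mathcal{C}(\mathcal{F})\cup\{\hat 0\}$ partially ordered by $\subseteq$ (it is a lattice). $\mathcal{P}_{n,n}$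 denotes the family of all perfect matchings of $K_{n,n}$ (viewed as spanning subgraphs), so $\mathcal{L}(\mathcal{P}_{n,n})$ consists of the empty graph and all matching-covered subgraphs of $K_{n,n}$. -}

module Defs where

open import Data.Nat using (ℕ)
open import Data.Fin using (Fin)
open import Data.Bool using (Bool; true; false; if_then_else_)
open import Data.List using (List; foldr; map)
open import Data.List using () renaming (allFin to allFinL)
open import Data.Product using (Σ; _×_; ∃; ∃-syntax)
open import Data.Sum using (_⊎_)
open import Data.Rational using (ℚ; 0ℚ; _+_; _≤_)
open import Relation.Binary.PropositionalEquality using (_≡_)
open import Function.Bundles using (_⇔_)

-- A subgraph of K_{n,n} (sides A = Fin n, B = Fin n), identified with its
-- edge set: G i j ≡ true iff the edge {a_i, b_j} is present.
Subgraph : ℕ → Set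
Subgraph n = Fin n → Fin n → Bool

_∋_∶_ : ∀ {n} → Subgraph n → Fin n → Fin n → Set
G ∋ i ∶ j = G i j ≡ true

_⊆ᴳ_ : ∀ {n} → Subgraph n → Subgraph n → Set
G ⊆ᴳ H = ∀ i j → G ∋ i ∶ j → H ∋ i ∶ j

Family : ℕ → Set₁
Family n = Subgraph n → Set

IsPerfectMatching : ∀ {n} → Subgraph n → Set
IsPerfectMatching {n} M =
  (∀ (i : Fin n) → Σ (Fin n) λ j → M ∋ i ∶ j × (∀ j' → M ∋ i ∶ j' → j' ≡ j)) ×
  (∀ (j : Fin n) → Σ (Fin n) λ i → M ∋ i ∶ j × (∀ i' → M ∋ i' ∶ j → i' ≡ i))

PerfectMatchings : (n : ℕ) → Family n
PerfectMatchings n = IsPerfectMatching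

Weight : ℕ → Set
Weight n = Fin n → Fin n → ℚ

NonNegative : ∀ {n} → Weight n → Set
NonNegative w = ∀ i j → 0ℚ ≤ w i j

sumℚ : List ℚ → ℚ
sumℚ = foldr _+_ 0ℚ

weight : ∀ {n} → Weight n → Subgraph n → ℚ
weight {n} w H =
  sumℚ (map (λ i → sumℚ (map (λ j → if H i j then w i j else 0ℚ) (allFinL n))) (allFinL n))

MinWeightPerfectMatchings : ∀ {n} → Weight n → Family n
MinWeightPerfectMatchings {n} w M =
  IsPerfectMatching M × (∀ M' → IsPerfectMatching M' → weight w M ≤ weight w M')

_∈Gw[_] : ∀ {n} → Fin n × Fin n → Weight n → Set
_∈Gw[_] {n} (i Data.Product., j) w = ∃[ M ] (MinWeightPerfectMatchings w M × M ∋ i ∶ j)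

_⊆Gw[_] : ∀ {n} → Subgraph n → Weight n → Set
G ⊆Gw[ w ] = ∀ i j → G ∋ i ∶ j → (i Data.Product., j) ∈Gw[ w ]

Covered : ∀ {n} → Family n → Subgraph n → Set₁
Covered {n} F G =
  Σ (Family n) λ S →
    (∀ H → S H → F H) ×
    (∃[ H ] S H) ×
    (∀ i j → G ∋ i ∶ j ⇔ (∃[ H ] (S H × H ∋ i ∶ j)))

IsEmpty : ∀ {n} → Subgraph n → Set
IsEmpty {n} G = ∀ (i j : Fin n) → G i j ≡ false

_∈𝓛_ : ∀ {n} → Subgraph n → Family n → Set₁
G ∈𝓛 F = Covered F G ⊎ IsEmpty G

-- A perfect matching of K_{n,n} is a permutation σ, of weight ∑ᵢ w i (σ i). For a
-- minimum-weight π the reduced costs c i k = w i (π k) - w i (π i) have no negative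
-- cycle (a cycle is itself a permutation), hence admit potentials, and these give an
-- optimal dual solution u, v: u i + v j ≤ w i j with ∑ u + ∑ v = w(π) (Egerváry).
-- By complementary slackness every edge of every minimum-weight matching, i.e. every
-- edge of G_w, is tight; so a perfect matching inside G_w weighs ∑ u + ∑ v = w(π).

module Submission where

open import Defs
open import Data.Bool using (true; false; if_then_else_)
open import Data.Fin using (Fin; zero; suc)
open import Data.Fin.Permutation
  using (Permutation′; _⟨$⟩ʳ_; _⟨$⟩ˡ_; permutation; inverseˡ; inverseʳ; _∘ₚ_; transpose)
  renaming (id to idₚ)
open import Data.Fin.Properties using (_≟_; suc-injective)
open import Data.List using (List; []; _∷_; _++_; [_]; length; map; tabulate; allFin)
open import Data.List.Membership.Propositional using (_∉_)
open import Data.List.Membership.Propositional.Properties using (∈-allFin; ∈-∃++)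
open import Data.List.Properties using (++-assoc; length-++; map-tabulate)
open import Data.List.Relation.Unary.All using ([]; _∷_; lookup)
open import Data.List.Relation.Unary.All.Properties using (All¬⇒¬Any; ¬Any⇒All¬)
open import Data.List.Relation.Unary.AllPairs using ([]; _∷_)
open import Data.List.Relation.Unary.Any using (here; there; any?)
open import Data.List.Relation.Unary.Unique.Propositional using (Unique)
open import Data.Nat using (ℕ; zero; suc; _≥_; s≤s)
import Data.Nat as ℕ
import Data.Nat.Properties as ℕ
open import Data.Product using (Σ-syntax; ∃-syntax; _×_; _,_; proj₁; proj₂)
open import Data.Rational using (ℚ; 0ℚ; _+_; _-_; -_; _≤_; _⊓_)
import Data.Rational.Properties as ℚ
open import Data.Rational.Solver using (module +-*-Solver)
open import Data.Sum using (_⊎_; inj₁; inj₂)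
open import Function using (_∘_)
open import Function.Bundles using (_⇔_; mk⇔; Equivalence)
open import Relation.Binary.Bundles using (DecTotalOrder)
open import Relation.Binary.Definitions using (DecidableEquality)
open import Relation.Binary.PropositionalEquality
  using (_≡_; _≢_; refl; sym; trans; cong; cong₂; subst; subst₂; module ≡-Reasoning)
open import Relation.Nullary using (does; yes; no; contradiction)
open import Relation.Nullary.Decidable using (dec-true; dec-false)
import Data.List.Extrema (DecTotalOrder.totalOrder ℚ.≤-decTotalOrder) as Extrema
open import Algebra.Properties.CommutativeMonoid.Sum ℚ.+-0-commutativeMonoid
  using (sum; sum-syntax; sum-cong-≗; sum-replicate-zero; ∑-distrib-+; ∑-permute)

open +-*-Solver

+-cancelʳ-≤ : ∀ {p q} r → p + r ≤ q + r → p ≤ q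
+-cancelʳ-≤ {p} {q} r p+r≤q+r =
  subst₂ _≤_ (cancel p) (cancel q) (ℚ.+-monoˡ-≤ (- r) p+r≤q+r)
  where
  cancel : ∀ x → x + r - r ≡ x
  cancel x = solve 2 (λ x r → x :+ r :- r := x) refl x r

+-cancelˡ-≤ : ∀ {p q} r → r + p ≤ r + q → p ≤ q
+-cancelˡ-≤ {p} {q} r r+p≤r+q =
  +-cancelʳ-≤ r (subst₂ _≤_ (ℚ.+-comm r p) (ℚ.+-comm r q) r+p≤r+q)

∑-mono-≤ : ∀ {n} {f g : Fin n → ℚ} → (∀ i → f i ≤ g i) → sum f ≤ sum g
∑-mono-≤ {zero}  f≤g = ℚ.≤-refl
∑-mono-≤ {suc n} f≤g = ℚ.+-mono-≤ (f≤g zero) (∑-mono-≤ (f≤g ∘ suc))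

∑-mono-≤-tight : ∀ {n} {f g : Fin n → ℚ} →
                 (∀ i → f i ≤ g i) → sum g ≤ sum f → ∀ i → g i ≤ f i
∑-mono-≤-tight {suc n} {f} {g} f≤g ∑g≤∑f zero =
  +-cancelʳ-≤ (sum (g ∘ suc))
    (ℚ.≤-trans ∑g≤∑f (ℚ.+-monoʳ-≤ (f zero) (∑-mono-≤ (f≤g ∘ suc))))
∑-mono-≤-tight {suc n} {f} {g} f≤g ∑g≤∑f (suc i) =
  ∑-mono-≤-tight (f≤g ∘ suc)
    (+-cancelˡ-≤ (g zero) (ℚ.≤-trans ∑g≤∑f (ℚ.+-monoˡ-≤ (sum (f ∘ suc)) (f≤g zero))))
    i

∑-agreeOff₁ : ∀ {n} {f g : Fin n → ℚ} k → (∀ i → i ≢ k → f i ≡ g i) →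
              sum f ≡ sum g + (f k - g k)
∑-agreeOff₁ {suc n} {f} {g} zero agree =
  trans (cong (f zero +_) (sum-cong-≗ (λ i → agree (suc i) λ ())))
        (solve 3 (λ f₀ g₀ s → f₀ :+ s := (g₀ :+ s) :+ (f₀ :- g₀)) refl
           (f zero) (g zero) (sum (g ∘ suc)))
∑-agreeOff₁ {suc n} {f} {g} (suc k) agree =
  trans (cong₂ _+_ (agree zero λ ()) (∑-agreeOff₁ k (λ i i≢k → agree (suc i) (i≢k ∘ suc-injective))))
        (sym (ℚ.+-assoc (g zero) (sum (g ∘ suc)) _))

∑-agreeOff₂ : ∀ {n} {f g : Fin n → ℚ} {k l} → k ≢ l →
              (∀ i → i ≢ k → i ≢ l → f i ≡ g i) →
              sum f ≡ sum g + ((f k - g k) + (f l - g l))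
∑-agreeOff₂ {k = zero}  {zero}  k≢l agree = contradiction refl k≢l
∑-agreeOff₂ {suc n} {f} {g} {zero} {suc l} k≢l agree =
  trans (cong (f zero +_) (∑-agreeOff₁ l (λ i i≢l → agree (suc i) (λ ()) (i≢l ∘ suc-injective))))
        (solve 5 (λ f₀ g₀ s fₗ gₗ → f₀ :+ (s :+ (fₗ :- gₗ))
                                    := (g₀ :+ s) :+ ((f₀ :- g₀) :+ (fₗ :- gₗ))) refl
           (f zero) (g zero) (sum (g ∘ suc)) (f (suc l)) (g (suc l)))
∑-agreeOff₂ {suc n} {f} {g} {suc k} {zero} k≢l agree =
  trans (cong (f zero +_) (∑-agreeOff₁ k (λ i i≢k → agree (suc i) (i≢k ∘ suc-injective) (λ ()))))
        (solve 5 (λ f₀ g₀ s fₖ gₖ → f₀ :+ (s :+ (fₖ :- gₖ))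
                                    := (g₀ :+ s) :+ ((fₖ :- gₖ) :+ (f₀ :- g₀))) refl
           (f zero) (g zero) (sum (g ∘ suc)) (f (suc k)) (g (suc k)))
∑-agreeOff₂ {suc n} {f} {g} {suc k} {suc l} k≢l agree =
  trans (cong₂ _+_ (agree zero (λ ()) (λ ()))
          (∑-agreeOff₂ (k≢l ∘ cong suc)
             (λ i i≢k i≢l → agree (suc i) (i≢k ∘ suc-injective) (i≢l ∘ suc-injective))))
        (sym (ℚ.+-assoc (g zero) (sum (g ∘ suc)) _))

∑-indicator : ∀ {n} (f : Fin n → ℚ) k → sum (λ j → if does (j ≟ k) then f j else 0ℚ) ≡ f k
∑-indicator {n} f k = begin
  sum δ                            ≡⟨ ∑-agreeOff₁ k δ-off ⟩
  sum {n} (λ _ → 0ℚ) + (δ k - 0ℚ)  ≡⟨ cong₂ (λ s x → s + (x - 0ℚ)) (sum-replicate-zero n) δ-at ⟩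
  0ℚ + (f k - 0ℚ)                  ≡⟨ solve 1 (λ x → con 0ℚ :+ (x :- con 0ℚ) := x) refl (f k) ⟩
  f k                              ∎
  where
  open ≡-Reasoning
  δ : Fin n → ℚ
  δ j = if does (j ≟ k) then f j else 0ℚ
  δ-off : ∀ j → j ≢ k → δ j ≡ 0ℚ
  δ-off j j≢k rewrite dec-false (j ≟ k) j≢k = refl
  δ-at : δ k ≡ f k
  δ-at rewrite dec-true (k ≟ k) refl = refl

sumℚ-allFin : ∀ n (f : Fin n → ℚ) → sumℚ (map f (allFin n)) ≡ sum f
sumℚ-allFin n f = trans (cong sumℚ (map-tabulate (λ i → i) f)) (sumℚ-tabulate f)
  where
  sumℚ-tabulate : ∀ {n} (f : Fin n → ℚ) → sumℚ (tabulate f) ≡ sum f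
  sumℚ-tabulate {zero}  f = refl
  sumℚ-tabulate {suc n} f = cong (f zero +_) (sumℚ-tabulate (f ∘ suc))

-- Perfect matchings as permutations

assignmentCost : ∀ {n} → (Fin n → Fin n → ℚ) → Permutation′ n → ℚ
assignmentCost {n} c σ = ∑[ i < n ] c i (σ ⟨$⟩ʳ i)

matching : ∀ {n} → Permutation′ n → Subgraph n
matching σ i j = does (j ≟ σ ⟨$⟩ʳ i)

matching-∋ : ∀ {n} (σ : Permutation′ n) i → matching σ ∋ i ∶ (σ ⟨$⟩ʳ i)
matching-∋ σ i = dec-true (σ ⟨$⟩ʳ i ≟ σ ⟨$⟩ʳ i) refl

∋-matching : ∀ {n} (σ : Permutation′ n) i j → matching σ ∋ i ∶ j → j ≡ σ ⟨$⟩ʳ i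
∋-matching σ i j _  with j ≟ σ ⟨$⟩ʳ i
∋-matching σ i j _  | yes j≡σi = j≡σi
∋-matching σ i j () | no _

matching-isPerfectMatching : ∀ {n} (σ : Permutation′ n) → IsPerfectMatching (matching σ)
matching-isPerfectMatching σ =
  (λ i → σ ⟨$⟩ʳ i , matching-∋ σ i , ∋-matching σ i) ,
  (λ j → σ ⟨$⟩ˡ j ,
         subst (matching σ ∋ σ ⟨$⟩ˡ j ∶_) (inverseʳ σ) (matching-∋ σ (σ ⟨$⟩ˡ j)) ,
         λ i σ∋ij → trans (sym (inverseˡ σ)) (cong (σ ⟨$⟩ˡ_) (sym (∋-matching σ i j σ∋ij))))

_≗ᴳ_ : ∀ {n} → Subgraph n → Subgraph n → Set
G ≗ᴳ H = ∀ i j → G i j ≡ H i j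

perfectMatching⇒permutation : ∀ {n} {M : Subgraph n} → IsPerfectMatching M →
                              Σ[ σ ∈ Permutation′ n ] M ≗ᴳ matching σ
perfectMatching⇒permutation {n} {M} (rows , cols) = σ , M≗σ
  where
  σ : Permutation′ n
  σ = permutation (proj₁ ∘ rows) (proj₁ ∘ cols)
        (λ j → sym (proj₂ (proj₂ (rows (proj₁ (cols j)))) j (proj₁ (proj₂ (cols j)))))
        (λ i → sym (proj₂ (proj₂ (cols (proj₁ (rows i)))) i (proj₁ (proj₂ (rows i)))))
  M≗σ : M ≗ᴳ matching σ
  M≗σ i j with M i j in Mij | j ≟ σ ⟨$⟩ʳ i
  ... | true  | yes _    = refl
  ... | true  | no j≢σi  = contradiction (proj₂ (proj₂ (rows i)) j Mij) j≢σi
  ... | false | yes refl = contradiction (trans (sym Mij) (proj₁ (proj₂ (rows i)))) λ ()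
  ... | false | no _     = refl

weight-matching : ∀ {n} (w : Weight n) {M : Subgraph n} (σ : Permutation′ n) →
                  M ≗ᴳ matching σ → weight w M ≡ assignmentCost w σ
weight-matching {n} w {M} σ M≗σ = begin
  weight w M
    ≡⟨ sumℚ-allFin n _ ⟩
  ∑[ i < n ] sumℚ (map (λ j → if M i j then w i j else 0ℚ) (allFin n))
    ≡⟨ sum-cong-≗ (λ i → trans (sumℚ-allFin n _)
                             (sum-cong-≗ λ j → cong (if_then w i j else 0ℚ) (M≗σ i j))) ⟩
  ∑[ i < n ] ∑[ j < n ] (if does (j ≟ σ ⟨$⟩ʳ i) then w i j else 0ℚ)
    ≡⟨ sum-cong-≗ (λ i → ∑-indicator (w i) (σ ⟨$⟩ʳ i)) ⟩
  assignmentCost w σ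
    ∎
  where open ≡-Reasoning

minWeight⇒optimal : ∀ {n} (w : Weight n) {M : Subgraph n} → MinWeightPerfectMatchings w M →
                    Σ[ σ ∈ Permutation′ n ] M ≗ᴳ matching σ ×
                      (∀ ρ → assignmentCost w σ ≤ assignmentCost w ρ)
minWeight⇒optimal w (M-pm , M-min) =
  σ , M≗σ , λ ρ → subst₂ _≤_ (weight-matching w σ M≗σ) (weight-matching w ρ (λ _ _ → refl))
                    (M-min (matching ρ) (matching-isPerfectMatching ρ))
  where
  σ : Permutation′ _
  σ = proj₁ (perfectMatching⇒permutation M-pm)
  M≗σ : _ ≗ᴳ matching σ
  M≗σ = proj₂ (perfectMatching⇒permutation M-pm)

transpose-left : ∀ {n} (a z : Fin n) → transpose a z ⟨$⟩ʳ a ≡ z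
transpose-left a z rewrite dec-true (a ≟ a) refl = refl

transpose-right : ∀ {n} (a z : Fin n) → transpose a z ⟨$⟩ʳ z ≡ a
transpose-right a z with z ≟ a
... | yes z≡a = z≡a
... | no _ rewrite dec-true (z ≟ z) refl = refl

transpose-other : ∀ {n} {a z i : Fin n} → i ≢ a → i ≢ z → transpose a z ⟨$⟩ʳ i ≡ i
transpose-other {a = a} {z} {i} i≢a i≢z
  rewrite dec-false (i ≟ a) i≢a | dec-false (i ≟ z) i≢z = refl

-- For distinct a ∷ zs, the cyclic permutation a ↦ z₁ ↦ ⋯ ↦ zₖ ↦ a.
cycle : ∀ {n} → Fin n → List (Fin n) → Permutation′ n
cycle a []       = idₚ
cycle a (z ∷ zs) = transpose a z ∘ₚ cycle a zs

cycle-fixes : ∀ {n} {a x : Fin n} zs → x ≢ a → x ∉ zs → cycle a zs ⟨$⟩ʳ x ≡ x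
cycle-fixes []           x≢a x∉zs = refl
cycle-fixes {a = a} (z ∷ zs) x≢a x∉zs =
  trans (cong (cycle a zs ⟨$⟩ʳ_) (transpose-other x≢a (x∉zs ∘ here)))
        (cycle-fixes zs x≢a (x∉zs ∘ there))

walkCost : ∀ {n} → (Fin n → Fin n → ℚ) → Fin n → List (Fin n) → ℚ
walkCost c a []       = 0ℚ
walkCost c a (y ∷ ys) = c a y + walkCost c y ys

walkCost-++ : ∀ {n} (c : Fin n → Fin n → ℚ) a xs y ys →
              walkCost c a (xs ++ y ∷ ys) ≡ walkCost c a (xs ++ [ y ]) + walkCost c y ys
walkCost-++ c a []       y ys = sym (cong (_+ walkCost c y ys) (ℚ.+-identityʳ (c a y)))
walkCost-++ c a (x ∷ xs) y ys =
  trans (cong (c a x +_) (walkCost-++ c x xs y ys)) (sym (ℚ.+-assoc (c a x) _ _))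

closedWalkCost : ∀ {n} → (Fin n → Fin n → ℚ) → Fin n → List (Fin n) → ℚ
closedWalkCost c a zs = walkCost c a (zs ++ [ a ])

cycle-next : ∀ {n} (a : Fin n) zs → Unique (a ∷ zs) →
             ∃[ rest ] zs ++ [ a ] ≡ (cycle a zs ⟨$⟩ʳ a) ∷ rest
cycle-next a []       _ = [] , refl
cycle-next a (z ∷ zs) ((a≢z ∷ _) ∷ (z∉zs ∷ _)) =
  zs ++ [ a ] ,
  cong (_∷ zs ++ [ a ])
    (sym (trans (cong (cycle a zs ⟨$⟩ʳ_) (transpose-left a z))
                (cycle-fixes zs (a≢z ∘ sym) (All¬⇒¬Any z∉zs))))

cycle-∷-cost : ∀ {n} (c : Fin n → Fin n → ℚ) a z zs → a ≢ z → z ∉ zs →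
  assignmentCost c (cycle a (z ∷ zs)) ≡
  assignmentCost c (cycle a zs) + ((c a z - c a (cycle a zs ⟨$⟩ʳ a)) + (c z (cycle a zs ⟨$⟩ʳ a) - c z z))
cycle-∷-cost c a z zs a≢z z∉zs = begin
  assignmentCost c σ
    ≡⟨ ∑-agreeOff₂ a≢z agree ⟩
  assignmentCost c σ′ + ((c a (σ ⟨$⟩ʳ a) - c a y) + (c z (σ ⟨$⟩ʳ z) - c z (σ′ ⟨$⟩ʳ z)))
    ≡⟨ cong₂ (λ t t′ → assignmentCost c σ′ + ((c a t - c a y) + (c z t′ - c z (σ′ ⟨$⟩ʳ z)))) σa≡z σz≡y ⟩
  assignmentCost c σ′ + ((c a z - c a y) + (c z y - c z (σ′ ⟨$⟩ʳ z)))
    ≡⟨ cong (λ t → assignmentCost c σ′ + ((c a z - c a y) + (c z y - c z t))) σ′z≡z ⟩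
  assignmentCost c σ′ + ((c a z - c a y) + (c z y - c z z))
    ∎
  where
  open ≡-Reasoning
  σ′ σ : Permutation′ _
  σ′ = cycle a zs
  σ  = cycle a (z ∷ zs)
  y : Fin _
  y  = σ′ ⟨$⟩ʳ a
  σ′z≡z : σ′ ⟨$⟩ʳ z ≡ z
  σ′z≡z = cycle-fixes zs (a≢z ∘ sym) z∉zs
  σa≡z : σ ⟨$⟩ʳ a ≡ z
  σa≡z = trans (cong (σ′ ⟨$⟩ʳ_) (transpose-left a z)) σ′z≡z
  σz≡y : σ ⟨$⟩ʳ z ≡ y
  σz≡y = cong (σ′ ⟨$⟩ʳ_) (transpose-right a z)
  agree : ∀ i → i ≢ a → i ≢ z → c i (σ ⟨$⟩ʳ i) ≡ c i (σ′ ⟨$⟩ʳ i)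
  agree i i≢a i≢z = cong (λ x → c i (σ′ ⟨$⟩ʳ x)) (transpose-other i≢a i≢z)

cycle-cost : ∀ {n} (c : Fin n → Fin n → ℚ) → (∀ i → c i i ≡ 0ℚ) →
             ∀ a zs → Unique (a ∷ zs) → assignmentCost c (cycle a zs) ≡ closedWalkCost c a zs
cycle-cost {n} c c-diag a [] _ = begin
  ∑[ i < n ] c i i    ≡⟨ sum-cong-≗ c-diag ⟩
  sum {n} (λ _ → 0ℚ)  ≡⟨ sum-replicate-zero n ⟩
  0ℚ                  ≡⟨ cong (_+ 0ℚ) (sym (c-diag a)) ⟩
  c a a + 0ℚ          ∎
  where open ≡-Reasoning
cycle-cost c c-diag a (z ∷ zs) ((a≢z ∷ a∉zs) ∷ (z∉zs ∷ zs-unique))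
  with cycle-next a zs (a∉zs ∷ zs-unique)
... | rest , zs++a≡ = begin
  assignmentCost c (cycle a (z ∷ zs))
    ≡⟨ cycle-∷-cost c a z zs a≢z (All¬⇒¬Any z∉zs) ⟩
  assignmentCost c (cycle a zs) + ((c a z - c a y) + (c z y - c z z))
    ≡⟨ cong₂ (λ s t → s + ((c a z - c a y) + (c z y - t)))
             (trans (cycle-cost c c-diag a zs (a∉zs ∷ zs-unique)) (cong (walkCost c a) zs++a≡))
             (c-diag z) ⟩
  (c a y + walkCost c y rest) + ((c a z - c a y) + (c z y - 0ℚ))
    ≡⟨ solve 4 (λ ay R az zy → (ay :+ R) :+ ((az :- ay) :+ (zy :- con 0ℚ)) := az :+ (zy :+ R)) refl
             (c a y) (walkCost c y rest) (c a z) (c z y) ⟩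
  c a z + (c z y + walkCost c y rest)
    ≡⟨ cong (λ l → c a z + walkCost c z l) (sym zs++a≡) ⟩
  closedWalkCost c a (z ∷ zs)
    ∎
  where
  open ≡-Reasoning
  y : Fin _
  y = cycle a zs ⟨$⟩ʳ a

permutations⇒cycles : ∀ {n} (c : Fin n → Fin n → ℚ) → (∀ i → c i i ≡ 0ℚ) →
                      (∀ σ → 0ℚ ≤ assignmentCost c σ) →
                      ∀ a zs → Unique (a ∷ zs) → 0ℚ ≤ closedWalkCost c a zs
permutations⇒cycles c c-diag c-nonneg a zs u =
  subst (0ℚ ≤_) (cycle-cost c c-diag a zs u) (c-nonneg (cycle a zs))

Repeats : ∀ {a} {A : Set a} → List A → Set a
Repeats l = ∃[ xs ] ∃[ b ] ∃[ ys ] ∃[ ts ] l ≡ xs ++ b ∷ ys ++ b ∷ ts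

unique⊎repeats : ∀ {a} {A : Set a} → DecidableEquality A → (l : List A) → Unique l ⊎ Repeats l
unique⊎repeats _≟ᴬ_ [] = inj₁ []
unique⊎repeats _≟ᴬ_ (x ∷ l) with any? (x ≟ᴬ_) l
... | yes x∈l = let ys , ts , l≡ = ∈-∃++ x∈l in inj₂ ([] , x , ys , ts , cong (x ∷_) l≡)
... | no x∉l with unique⊎repeats _≟ᴬ_ l
...   | inj₁ l-unique                 = inj₁ (¬Any⇒All¬ l x∉l ∷ l-unique)
...   | inj₂ (xs , b , ys , ts , l≡) = inj₂ (x ∷ xs , b , ys , ts , cong (x ∷_) l≡)

closedWalkCost-return : ∀ {n} (c : Fin n → Fin n → ℚ) a ys ts →
  closedWalkCost c a (ys ++ a ∷ ts) ≡ closedWalkCost c a ys + closedWalkCost c a ts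
closedWalkCost-return c a ys ts =
  trans (cong (walkCost c a) (++-assoc ys (a ∷ ts) [ a ])) (walkCost-++ c a ys a (ts ++ [ a ]))

closedWalkCost-detour : ∀ {n} (c : Fin n → Fin n → ℚ) a xs b ys ts →
  closedWalkCost c a (xs ++ b ∷ ys ++ b ∷ ts) ≡ closedWalkCost c a (xs ++ b ∷ ts) + closedWalkCost c b ys
closedWalkCost-detour c a xs b ys ts = begin
  walkCost c a ((xs ++ b ∷ ys ++ b ∷ ts) ++ [ a ])
    ≡⟨ cong (walkCost c a) (trans (++-assoc xs (b ∷ ys ++ b ∷ ts) [ a ])
                                  (cong (λ l → xs ++ b ∷ l) (++-assoc ys (b ∷ ts) [ a ]))) ⟩
  walkCost c a (xs ++ b ∷ ys ++ b ∷ ts ++ [ a ])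
    ≡⟨ walkCost-++ c a xs b _ ⟩
  X + walkCost c b (ys ++ b ∷ ts ++ [ a ])
    ≡⟨ cong (X +_) (walkCost-++ c b ys b _) ⟩
  X + (Y + Z)
    ≡⟨ solve 3 (λ x y z → x :+ (y :+ z) := (x :+ z) :+ y) refl X Y Z ⟩
  (X + Z) + Y
    ≡⟨ cong (_+ Y) (sym (walkCost-++ c a xs b _)) ⟩
  walkCost c a (xs ++ b ∷ ts ++ [ a ]) + Y
    ≡⟨ cong (λ l → walkCost c a l + Y) (sym (++-assoc xs (b ∷ ts) [ a ])) ⟩
  closedWalkCost c a (xs ++ b ∷ ts) + Y
    ∎
  where
  open ≡-Reasoning
  X = walkCost c a (xs ++ [ b ])
  Y = walkCost c b (ys ++ [ b ])
  Z = walkCost c b (ts ++ [ a ])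

ClosedWalksNonNegative : ∀ {n} → (Fin n → Fin n → ℚ) → Set
ClosedWalksNonNegative c = ∀ a zs → 0ℚ ≤ closedWalkCost c a zs

length-++-∷ˡ : ∀ {a} {A : Set a} (xs : List A) y ys → length xs ℕ.< length (xs ++ y ∷ ys)
length-++-∷ˡ xs y ys = subst (length xs ℕ.<_) (sym (length-++ xs)) (ℕ.m<m+n (length xs) (s≤s ℕ.z≤n))

length-++-∷ʳ : ∀ {a} {A : Set a} (xs : List A) y ys → length ys ℕ.< length (xs ++ y ∷ ys)
length-++-∷ʳ xs y ys = subst (length ys ℕ.<_) (sym (length-++ xs)) (ℕ.m≤n+m (suc (length ys)) (length xs))

-- A closed walk with a repeated vertex splits into two shorter closed walks.
cycles⇒closedWalks : ∀ {n} (c : Fin n → Fin n → ℚ) →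
                     (∀ a zs → Unique (a ∷ zs) → 0ℚ ≤ closedWalkCost c a zs) →
                     ClosedWalksNonNegative c
cycles⇒closedWalks c cycles-nonneg a zs = go (suc (length zs)) a zs ℕ.≤-refl
  where
  go : ∀ N a zs → length zs ℕ.< N → 0ℚ ≤ closedWalkCost c a zs
  go (suc N) a zs (s≤s |zs|≤N) with unique⊎repeats _≟_ (a ∷ zs)
  go (suc N) a zs (s≤s |zs|≤N) | inj₁ a∷zs-unique = cycles-nonneg a zs a∷zs-unique
  go (suc N) a .(ys ++ a ∷ ts) (s≤s |zs|≤N) | inj₂ ([] , .a , ys , ts , refl) =
    subst (0ℚ ≤_) (sym (closedWalkCost-return c a ys ts))
      (ℚ.+-mono-≤ (go N a ys (ℕ.<-≤-trans (length-++-∷ˡ ys a ts) |zs|≤N))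
                  (go N a ts (ℕ.<-≤-trans (length-++-∷ʳ ys a ts) |zs|≤N)))
  go (suc N) a .(xs ++ b ∷ ys ++ b ∷ ts) (s≤s |zs|≤N) | inj₂ (.a ∷ xs , b , ys , ts , refl) =
    subst (0ℚ ≤_) (sym (closedWalkCost-detour c a xs b ys ts))
      (ℚ.+-mono-≤ (go N a (xs ++ b ∷ ts) (ℕ.<-≤-trans |xs++b∷ts|< |zs|≤N))
                  (go N b ys (ℕ.<-≤-trans |ys|< |zs|≤N)))
    where
    |xs++b∷ts|< : length (xs ++ b ∷ ts) ℕ.< length (xs ++ b ∷ ys ++ b ∷ ts)
    |xs++b∷ts|< = subst₂ ℕ._<_ (sym (length-++ xs)) (sym (length-++ xs))
      (ℕ.+-monoʳ-< (length xs) (s≤s (length-++-∷ʳ ys b ts)))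
    |ys|< : length ys ℕ.< length (xs ++ b ∷ ys ++ b ∷ ts)
    |ys|< = ℕ.<-trans (length-++-∷ˡ ys b ts) (length-++-∷ʳ xs b (ys ++ b ∷ ts))

-- Potentials

shortcut : ∀ {m} → (Fin (suc m) → Fin (suc m) → ℚ) → Fin m → Fin m → ℚ
shortcut c a b = c (suc a) (suc b) ⊓ (c (suc a) zero + c zero (suc b))

shortcut-lift : ∀ {m} (c : Fin (suc m) → Fin (suc m) → ℚ) a ys b →
  ∃[ L ] walkCost c (suc a) (L ++ [ suc b ]) ≡ walkCost (shortcut c) a (ys ++ [ b ])
shortcut-lift c a []       b with ℚ.⊓-sel (c (suc a) (suc b)) (c (suc a) zero + c zero (suc b))
... | inj₁ direct = [] , cong (_+ 0ℚ) (sym direct)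
... | inj₂ detour = [ zero ] ,
  trans (sym (ℚ.+-assoc (c (suc a) zero) (c zero (suc b)) 0ℚ)) (cong (_+ 0ℚ) (sym detour))
shortcut-lift c a (y ∷ ys) b =
  let L₁ , e₁ = shortcut-lift c a [] y
      L₂ , e₂ = shortcut-lift c y ys b
  in L₁ ++ suc y ∷ L₂ , (begin
    walkCost c (suc a) ((L₁ ++ suc y ∷ L₂) ++ [ suc b ])
      ≡⟨ cong (walkCost c (suc a)) (++-assoc L₁ (suc y ∷ L₂) [ suc b ]) ⟩
    walkCost c (suc a) (L₁ ++ suc y ∷ L₂ ++ [ suc b ])
      ≡⟨ walkCost-++ c (suc a) L₁ (suc y) _ ⟩
    walkCost c (suc a) (L₁ ++ [ suc y ]) + walkCost c (suc y) (L₂ ++ [ suc b ])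
      ≡⟨ cong₂ _+_ e₁ e₂ ⟩
    (shortcut c a y + 0ℚ) + walkCost (shortcut c) y (ys ++ [ b ])
      ≡⟨ cong (_+ walkCost (shortcut c) y (ys ++ [ b ])) (ℚ.+-identityʳ (shortcut c a y)) ⟩
    walkCost (shortcut c) a (y ∷ ys ++ [ b ])
      ∎)
  where open ≡-Reasoning

shortcut-closedWalks : ∀ {m} (c : Fin (suc m) → Fin (suc m) → ℚ) →
                       ClosedWalksNonNegative c → ClosedWalksNonNegative (shortcut c)
shortcut-closedWalks c c-nonneg a zs =
  let L , e = shortcut-lift c a zs a in subst (0ℚ ≤_) e (c-nonneg (suc a) L)

minimum : ∀ {m} (f : Fin m → ℚ) →
          Σ[ x ∈ ℚ ] (∀ i → x ≤ f i) × (Fin m → ∃[ i ] x ≡ f i)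
minimum {zero}  f = 0ℚ , (λ ()) , (λ ())
minimum {suc m} f =
  f i* , (λ i → lookup (Extrema.f[argmin]≤f[xs] {f = f} zero (allFin (suc m))) (∈-allFin i)) ,
  (λ _ → i* , refl)
  where
  i* : Fin (suc m)
  i* = Extrema.argmin f zero (allFin (suc m))

-- Shortcutting vertex zero keeps closed walks non-negative, and a potential p′ of the
-- shortcut costs extends by p zero = minᵢ (p′ i + c (suc i) zero).
potentials : ∀ {n} (c : Fin n → Fin n → ℚ) → ClosedWalksNonNegative c →
             Σ[ p ∈ (Fin n → ℚ) ] ∀ i k → p k ≤ p i + c i k
potentials {zero}  c _        = (λ ()) , (λ ())
potentials {suc m} c c-nonneg = p , p-feasible
  where
  open ℚ.≤-Reasoning
  shortcut-potential : Σ[ p′ ∈ (Fin m → ℚ) ] ∀ i k → p′ k ≤ p′ i + shortcut c i k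
  shortcut-potential = potentials (shortcut c) (shortcut-closedWalks c c-nonneg)
  p′ : Fin m → ℚ
  p′ = proj₁ shortcut-potential
  p′-feasible : ∀ i k → p′ k ≤ p′ i + shortcut c i k
  p′-feasible = proj₂ shortcut-potential
  min : Σ[ x ∈ ℚ ] (∀ i → x ≤ p′ i + c (suc i) zero) × (Fin m → ∃[ i ] x ≡ p′ i + c (suc i) zero)
  min = minimum (λ i → p′ i + c (suc i) zero)
  p : Fin (suc m) → ℚ
  p zero    = proj₁ min
  p (suc k) = p′ k
  p-feasible : ∀ i k → p k ≤ p i + c i k
  p-feasible zero zero =
    subst₂ (λ x y → x ≤ p zero + y) (ℚ.+-identityʳ (p zero)) (ℚ.+-identityʳ (c zero zero))
      (ℚ.+-monoʳ-≤ (p zero) (c-nonneg zero []))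
  p-feasible (suc i) zero = proj₁ (proj₂ min) i
  p-feasible zero (suc k) = let i , p₀≡ = proj₂ (proj₂ min) k in begin
    p′ k                                           ≤⟨ p′-feasible i k ⟩
    p′ i + shortcut c i k                          ≤⟨ ℚ.+-monoʳ-≤ (p′ i) (ℚ.p⊓q≤q (c (suc i) (suc k)) _) ⟩
    p′ i + (c (suc i) zero + c zero (suc k))       ≡⟨ sym (ℚ.+-assoc (p′ i) _ _) ⟩
    (p′ i + c (suc i) zero) + c zero (suc k)       ≡⟨ cong (_+ c zero (suc k)) (sym p₀≡) ⟩
    p zero + c zero (suc k)                        ∎
  p-feasible (suc i) (suc k) =
    ℚ.≤-trans (p′-feasible i k) (ℚ.+-monoʳ-≤ (p′ i) (ℚ.p⊓q≤p _ (c (suc i) zero + c zero (suc k))))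

-- Duality for the assignment problem

DualFeasible : ∀ {n} → (Fin n → Fin n → ℚ) → (Fin n → ℚ) → (Fin n → ℚ) → Set
DualFeasible w u v = ∀ i j → u i + v j ≤ w i j

FeasibleDual : ∀ {n} → (Fin n → Fin n → ℚ) → ℚ → Set
FeasibleDual {n} w t = Σ[ u ∈ (Fin n → ℚ) ] Σ[ v ∈ (Fin n → ℚ) ] DualFeasible w u v × sum u + sum v ≡ t

∑-dual : ∀ {n} (u v : Fin n → ℚ) (σ : Permutation′ n) →
         ∑[ i < n ] (u i + v (σ ⟨$⟩ʳ i)) ≡ sum u + sum v
∑-dual u v σ = trans (∑-distrib-+ u (v ∘ (σ ⟨$⟩ʳ_))) (cong (sum u +_) (sym (∑-permute v σ)))

-- The dual solution is u i = w i (π i) - p i, v (π k) = p k for potentials p of the reduced costs c.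
egervary : ∀ {n} (w : Fin n → Fin n → ℚ) (π : Permutation′ n) →
           (∀ σ → assignmentCost w π ≤ assignmentCost w σ) → FeasibleDual w (assignmentCost w π)
egervary {n} w π π-optimal = u , v , feasible , trans (sym (∑-dual u v π)) (sum-cong-≗ tight)
  where
  c : Fin n → Fin n → ℚ
  c i k = w i (π ⟨$⟩ʳ k) - w i (π ⟨$⟩ʳ i)

  c-diag : ∀ i → c i i ≡ 0ℚ
  c-diag i = ℚ.+-inverseʳ (w i (π ⟨$⟩ʳ i))

  c-nonneg : ∀ ρ → 0ℚ ≤ assignmentCost c ρ
  c-nonneg ρ = +-cancelʳ-≤ (assignmentCost w π)
    (subst₂ _≤_ (sym (ℚ.+-identityˡ _)) shift (π-optimal (ρ ∘ₚ π)))
    where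
    shift : assignmentCost w (ρ ∘ₚ π) ≡ assignmentCost c ρ + assignmentCost w π
    shift = trans (sum-cong-≗ λ i → solve 2 (λ a b → a := (a :- b) :+ b) refl
                                       (w i (π ⟨$⟩ʳ (ρ ⟨$⟩ʳ i))) (w i (π ⟨$⟩ʳ i)))
                  (∑-distrib-+ (λ i → c i (ρ ⟨$⟩ʳ i)) (λ i → w i (π ⟨$⟩ʳ i)))

  potential : Σ[ p ∈ (Fin n → ℚ) ] ∀ i k → p k ≤ p i + c i k
  potential = potentials c (cycles⇒closedWalks c (permutations⇒cycles c c-diag c-nonneg))

  p : Fin n → ℚ
  p = proj₁ potential

  u v : Fin n → ℚ
  u i = w i (π ⟨$⟩ʳ i) - p i
  v j = p (π ⟨$⟩ˡ j)

  feasible-on-π : ∀ i k → u i + v (π ⟨$⟩ʳ k) ≤ w i (π ⟨$⟩ʳ k)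
  feasible-on-π i k = begin
    u i + p (π ⟨$⟩ˡ (π ⟨$⟩ʳ k)) ≡⟨ cong (λ x → u i + p x) (inverseˡ π) ⟩
    u i + p k                   ≤⟨ ℚ.+-monoʳ-≤ (u i) (proj₂ potential i k) ⟩
    u i + (p i + c i k)         ≡⟨ solve 3 (λ a q b → (a :- q) :+ (q :+ (b :- a)) := b) refl
                                     (w i (π ⟨$⟩ʳ i)) (p i) (w i (π ⟨$⟩ʳ k)) ⟩
    w i (π ⟨$⟩ʳ k)              ∎
    where open ℚ.≤-Reasoning

  feasible : DualFeasible w u v
  feasible i j = subst (λ j → u i + v j ≤ w i j) (inverseʳ π) (feasible-on-π i (π ⟨$⟩ˡ j))

  tight : ∀ i → u i + v (π ⟨$⟩ʳ i) ≡ w i (π ⟨$⟩ʳ i)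
  tight i = trans (cong (λ x → u i + p x) (inverseˡ π))
                  (solve 2 (λ a q → (a :- q) :+ q := a) refl (w i (π ⟨$⟩ʳ i)) (p i))

complementarySlackness : ∀ {n} {w : Fin n → Fin n → ℚ} {u v : Fin n → ℚ} → DualFeasible w u v →
                         ∀ σ → assignmentCost w σ ≤ sum u + sum v →
                         ∀ i → w i (σ ⟨$⟩ʳ i) ≤ u i + v (σ ⟨$⟩ʳ i)
complementarySlackness {u = u} {v} feasible σ σ≤dual =
  ∑-mono-≤-tight (λ i → feasible i (σ ⟨$⟩ʳ i)) (subst (_ ≤_) (sym (∑-dual u v σ)) σ≤dual)

minWeight-dual : ∀ {n} (w : Weight n) {P : Subgraph n} → MinWeightPerfectMatchings w P →
                 FeasibleDual w (weight w P)
minWeight-dual w P-min =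
  let π , P≗π , π-optimal = minWeight⇒optimal w P-min
      u , v , feasible , objective = egervary w π π-optimal
  in u , v , feasible , trans objective (sym (weight-matching w π P≗π))

Gw-tight : ∀ {n} (w : Weight n) {u v : Fin n → ℚ} {P : Subgraph n} →
           DualFeasible w u v → IsPerfectMatching P → sum u + sum v ≡ weight w P →
           ∀ i j → (i , j) ∈Gw[ w ] → w i j ≤ u i + v j
Gw-tight w {u} {v} {P} feasible P-pm objective i j (Q , Q-min , Q∋ij) =
  subst (λ j → w i j ≤ u i + v j) (sym j≡ρi) (complementarySlackness feasible ρ ρ≤dual i)
  where
  ρ : Permutation′ _
  ρ = proj₁ (perfectMatching⇒permutation (proj₁ Q-min))
  Q≗ρ : Q ≗ᴳ matching ρ
  Q≗ρ = proj₂ (perfectMatching⇒permutation (proj₁ Q-min))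
  j≡ρi : j ≡ ρ ⟨$⟩ʳ i
  j≡ρi = ∋-matching ρ i j (trans (sym (Q≗ρ i j)) Q∋ij)
  ρ≤dual : assignmentCost w ρ ≤ sum u + sum v
  ρ≤dual = subst₂ _≤_ (weight-matching w ρ Q≗ρ) (sym objective) (proj₂ Q-min P P-pm)

-- The dual solution of a minimum-weight matching through any edge of H is tight on all of H.
perfectMatching⊆Gw⇒minWeight : ∀ {m} (w : Weight (suc m)) {H : Subgraph (suc m)} →
                               IsPerfectMatching H → H ⊆Gw[ w ] → MinWeightPerfectMatchings w H
perfectMatching⊆Gw⇒minWeight {m} w {H} H-pm H⊆Gw = H-pm , below (minWeight-dual w P-min)
  where
  τ : Permutation′ (suc m)
  τ = proj₁ (perfectMatching⇒permutation H-pm)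
  H≗τ : H ≗ᴳ matching τ
  H≗τ = proj₂ (perfectMatching⇒permutation H-pm)
  H∋ : ∀ i → H ∋ i ∶ (τ ⟨$⟩ʳ i)
  H∋ i = trans (H≗τ i (τ ⟨$⟩ʳ i)) (matching-∋ τ i)
  P : Subgraph (suc m)
  P = proj₁ (H⊆Gw zero (τ ⟨$⟩ʳ zero) (H∋ zero))
  P-min : MinWeightPerfectMatchings w P
  P-min = proj₁ (proj₂ (H⊆Gw zero (τ ⟨$⟩ʳ zero) (H∋ zero)))

  below : FeasibleDual w (weight w P) → ∀ M → IsPerfectMatching M → weight w H ≤ weight w M
  below (u , v , feasible , objective) M M-pm = begin
    weight w H                           ≡⟨ weight-matching w τ H≗τ ⟩
    assignmentCost w τ                   ≤⟨ ∑-mono-≤ H-tight ⟩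
    ∑[ i < suc m ] (u i + v (τ ⟨$⟩ʳ i))  ≡⟨ ∑-dual u v τ ⟩
    sum u + sum v                        ≡⟨ objective ⟩
    weight w P                           ≤⟨ proj₂ P-min M M-pm ⟩
    weight w M                           ∎
    where
    open ℚ.≤-Reasoning
    H-tight : ∀ i → w i (τ ⟨$⟩ʳ i) ≤ u i + v (τ ⟨$⟩ʳ i)
    H-tight i = Gw-tight w {u} {v} feasible (proj₁ P-min) objective i _ (H⊆Gw i (τ ⟨$⟩ʳ i) (H∋ i))

mainTheorem1 : (n : ℕ) → n ≥ 1 → (w : Weight n) → NonNegative w →
    (G : Subgraph n) →
    (G ∈𝓛 MinWeightPerfectMatchings w) ⇔ ((G ∈𝓛 PerfectMatchings n) × G ⊆Gw[ w ])
mainTheorem1 (suc m) _ w _ G = mk⇔ to from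
  where
  to : G ∈𝓛 MinWeightPerfectMatchings w → (G ∈𝓛 PerfectMatchings (suc m)) × G ⊆Gw[ w ]
  to (inj₂ G-empty) = inj₂ G-empty , λ i j G∋ij → contradiction (trans (sym (G-empty i j)) G∋ij) λ ()
  to (inj₁ (S , S-min , S-nonempty , S-covers)) =
    inj₁ (S , (λ H → proj₁ ∘ S-min H) , S-nonempty , S-covers) ,
    λ i j G∋ij → let H , H∈S , H∋ij = Equivalence.to (S-covers i j) G∋ij in H , S-min H H∈S , H∋ij
  from : (G ∈𝓛 PerfectMatchings (suc m)) × G ⊆Gw[ w ] → G ∈𝓛 MinWeightPerfectMatchings w
  from (inj₂ G-empty , _) = inj₂ G-empty
  from (inj₁ (S , S-pm , S-nonempty , S-covers) , G⊆Gw) = inj₁ (S , S-min , S-nonempty , S-covers)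
    where
    S-min : ∀ H → S H → MinWeightPerfectMatchings w H
    S-min H H∈S = perfectMatching⊆Gw⇒minWeight w (S-pm H H∈S)
      (λ i j H∋ij → G⊆Gw i j (Equivalence.from (S-covers i j) (H , H∈S , H∋ij)))
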